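{- Let $G$ be an agent pattern and $G^\star:=\{\{a\}\mid\exists A\in G \text{ with } a\in A\}$. Let $\mathcal{S}_G$ be the set of all simplices $S$ with $G^\star\subseteq S^\circ$. Then $S\sim_G S$ for every $S\in\mathcal{S}_G$, and for every simplex $S\notin\mathcal{S}_G$ there is no simplex $T$ with $S\sim_G T$ (equivalently, $\sim_G$ is reflexive on $\mathcal{S}_G\times\mathcal{S}_G$ and relates no pair outside it).
   Context: Fix a finite set $\mathsf{Ag}$ of agents and let $\mathsf{Ag}_{si}=\{(A,i)\mid A\subseteq\mathsf{Ag},\ i\in\mathbb{N}\}$. For $S\subseteq\mathsf{Ag}_{si}$, $(A,i)\in S$ is maximal in $S$ if $|A|\ge|B|$ for all $(B,j)\in S$. A nonempty $S\subseteq\mathsf{Ag}_{si}$ is a simplex if (S1) it has a unique maximal element $\max(S)$; (S2) for every $(B,i)\in S$ and $C\subseteq B$ there is exactly one $j\in\mathbb{N}$ with $(C,j)\in S$; (S3) if $(B,i)\in S$ and $(A,j)=\max(S)$ then $B\subseteq A$. For $S\subseteq\mathsf{Ag}_{si}$ let $S^\circ=\{A\mid\exists i\in\mathbb{N}.\ (A,i)\in S\}$. An agent pattern is a set $G\subseteq\mathcal{P}(\mathsf{Ag})\setminus\{\emptyset\}$. For simplices $S,T$, $S\sim_G T$ iff $G\subseteq(S\cap T)^\circ$. -}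

module Defs where

open import Data.Nat using (ℕ; _≤_)
open import Data.Fin.Subset using (Subset; _⊆_; _∈_; ⁅_⁆; ∣_∣; Nonempty)
open import Data.Fin using (Fin)
open import Data.Product using (Σ; ∃; ∃-syntax; _×_; _,_)
open import Relation.Binary.PropositionalEquality using (_≡_)

-- Agents: Fin n.  Ag_si = Subset n × ℕ.  Subsets of Ag_si are predicates.
AgSi : ℕ → Set
AgSi n = Subset n × ℕ

SetSi : ℕ → Set₁
SetSi n = AgSi n → Set

Maximal : ∀ {n} → SetSi n → AgSi n → Set
Maximal S (A , i) = S (A , i) × (∀ B j → S (B , j) → ∣ B ∣ ≤ ∣ A ∣)

record Simplex {n : ℕ} (S : SetSi n) : Set where
  field
    nonempty : ∃[ x ] S x
    S1 : ∃[ x ] (Maximal S x × (∀ y → Maximal S y → y ≡ x))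
    S2 : ∀ B i → S (B , i) → ∀ C → C ⊆ B →
         ∃[ j ] (S (C , j) × (∀ k → S (C , k) → k ≡ j))
    S3 : ∀ B i A j → S (B , i) → Maximal S (A , j) → B ⊆ A

Circ : ∀ {n} → SetSi n → Subset n → Set
Circ S A = ∃[ i ] S (A , i)

AgentPattern : ∀ {n} → (Subset n → Set) → Set
AgentPattern G = ∀ A → G A → Nonempty A

Rel : ∀ {n} → (Subset n → Set) → SetSi n → SetSi n → Set
Rel G S T = ∀ A → G A → ∃[ i ] (S (A , i) × T (A , i))

GStar : ∀ {n} → (Subset n → Set) → Subset n → Set
GStar G X = ∃[ a ] (X ≡ ⁅ a ⁆ × ∃[ A ] (G A × a ∈ A))

InSG : ∀ {n} → (Subset n → Set) → SetSi n → Set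
InSG G S = Simplex S × (∀ X → GStar G X → Circ S X)

{-# OPTIONS --safe #-}
module Submission where

-- A simplex is closed under faces and every face lies below its maximal
-- element, so it contains a set of agents exactly when it contains all the
-- singletons of that set.  Hence G* ⊆ S° is equivalent to G ⊆ S°, which makes
-- S ∼_G S hold, and which is in turn implied by S ∼_G T for any T.

open import Defs
open import Data.Nat using (ℕ)
open import Data.Fin.Subset using (Subset; _⊆_; _∈_; ⁅_⁆)
open import Data.Fin.Subset.Properties using (x∈⁅x⁆; x∈⁅y⁆⇒x≡y)
open import Data.Product using (∃-syntax; _×_; _,_; proj₁)
open import Relation.Nullary using (¬_)
open import Relation.Binary.PropositionalEquality using (refl; sym; subst)

private
  variable
    n : ℕ

x∈p⇒⁅x⁆⊆p : ∀ {x} {p : Subset n} → x ∈ p → ⁅ x ⁆ ⊆ p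
x∈p⇒⁅x⁆⊆p {p = p} x∈p y∈⁅x⁆ = subst (_∈ p) (sym (x∈⁅y⁆⇒x≡y _ y∈⁅x⁆)) x∈p

module _ {S : SetSi n} (simplex : Simplex S) where
  open Simplex simplex

  Circ-face : ∀ {B C} → Circ S B → C ⊆ B → Circ S C
  Circ-face (i , SBi) C⊆B with S2 _ i SBi _ C⊆B
  ... | j , SCj , _ = j , SCj

  Circ-fromSingletons : ∀ {A} → (∀ a → a ∈ A → Circ S ⁅ a ⁆) → Circ S A
  Circ-fromSingletons {A} singletons with S1
  ... | (M , k) , max , _ = Circ-face (k , proj₁ max) A⊆M
    where
    A⊆M : A ⊆ M
    A⊆M {a} a∈A with singletons a a∈A
    ... | i , Sa = S3 ⁅ a ⁆ i M k Sa max (x∈⁅x⁆ a)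

  GStar⊆Circ⇒G⊆Circ : ∀ {G} → (∀ X → GStar G X → Circ S X) → ∀ A → G A → Circ S A
  GStar⊆Circ⇒G⊆Circ star A GA =
    Circ-fromSingletons (λ a a∈A → star ⁅ a ⁆ (a , refl , A , GA , a∈A))

  G⊆Circ⇒GStar⊆Circ : ∀ {G} → (∀ A → G A → Circ S A) → ∀ X → GStar G X → Circ S X
  G⊆Circ⇒GStar⊆Circ G⊆S° X (a , X≡⁅a⁆ , A , GA , a∈A) =
    subst (Circ S) (sym X≡⁅a⁆) (Circ-face (G⊆S° A GA) (x∈p⇒⁅x⁆⊆p a∈A))

G⊆Circ⇒Rel-refl : ∀ {G} {S : SetSi n} → (∀ A → G A → Circ S A) → Rel G S S
G⊆Circ⇒Rel-refl G⊆S° A GA with G⊆S° A GA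
... | i , SAi = i , SAi , SAi

Rel⇒G⊆Circˡ : ∀ {G} {S T : SetSi n} → Rel G S T → ∀ A → G A → Circ S A
Rel⇒G⊆Circˡ rel A GA with rel A GA
... | i , SAi , _ = i , SAi

lemma2p7 : (n : ℕ) (G : Subset n → Set) → AgentPattern G →
    ((S : SetSi n) → InSG G S → Rel G S S)
    × ((S : SetSi n) → Simplex S → ¬ InSG G S → ¬ (∃[ T ] (Simplex T × Rel G S T)))
lemma2p7 n G _ = reflexive , outside
  where
  reflexive : (S : SetSi n) → InSG G S → Rel G S S
  reflexive S (simplex , star) =
    G⊆Circ⇒Rel-refl (GStar⊆Circ⇒G⊆Circ simplex star)

  outside : (S : SetSi n) → Simplex S → ¬ InSG G S → ¬ (∃[ T ] (Simplex T × Rel G S T))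
  outside S simplex S∉𝒮G (T , _ , rel) =
    S∉𝒮G (simplex , G⊆Circ⇒GStar⊆Circ simplex (Rel⇒G⊆Circˡ rel))
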